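{- Let $\mathbb{C}$ be a small category with set of objects $\mathbb{C}_0$, let $\mathbb{C}_0/{\cong}$ be the set of isomorphism classes of objects, let $s:\mathbb{C}_0/{\cong}\to\mathbb{C}_0$ be a section of the quotient map, and let $T'=(\mathbb{C}_0/{\cong},\,s)\in\mathbf{Fam}(\mathbb{C})$. If $T'$ is a strong generic object for the family fibration $p:\mathbf{Fam}(\mathbb{C})\to\mathbf{Set}$, i.e. for every $X\in\mathbf{Fam}(\mathbb{C})$ there exists a unique cartesian morphism $X\to T'$, then $\mathbb{C}$ is gaunt, i.e. every automorphism in $\mathbb{C}$ is an identity morphism.
   Context: $\mathbf{Fam}(\mathbb{C})$ has objects pairs $(I,c)$ with $I$ a set and $c:I\to\mathbb{C}_0$; a morphism $(J,d)\to(I,c)$ is a function $u:J\to I$ together with, for each $j\in J$, a morphism $d(j)\to c(u(j))$ in $\mathbb{C}$; $p(I,c)=I$. A morphism $f:E\to F$ is cartesian for $p$ if for every $g:H\to F$ and every $v:pH\to pE$ with $pf\circ v=pg$ there is a unique $h:H\to E$ with $ph=v$ and $f\circ h=g$. -}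

module Defs where

open import Data.Product using (Σ; Σ-syntax; _×_; _,_; ∃-syntax)
open import Relation.Binary.PropositionalEquality using (_≡_; subst)
open import Function.Bundles using (_⇔_)

record Category : Set₁ where
  infixr 9 _∘_
  field
    Obj  : Set
    Hom  : Obj → Obj → Set
    id   : {A : Obj} → Hom A A
    _∘_  : {A B C : Obj} → Hom B C → Hom A B → Hom A C
    identityˡ : {A B : Obj} (f : Hom A B) → id ∘ f ≡ f
    identityʳ : {A B : Obj} (f : Hom A B) → f ∘ id ≡ f
    assoc : {A B C D : Obj} (f : Hom C D) (g : Hom B C) (h : Hom A B) →
            (f ∘ g) ∘ h ≡ f ∘ (g ∘ h)

module _ (ℂ : Category) where
  open Category ℂ

  IsIso : {A B : Obj} → Hom A B → Set
  IsIso {A} {B} f = Σ[ g ∈ Hom B A ] ((g ∘ f ≡ id) × (f ∘ g ≡ id))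

  _≅_ : Obj → Obj → Set
  A ≅ B = Σ[ f ∈ Hom A B ] IsIso f

  Gaunt : Set
  Gaunt = {A : Obj} (f : Hom A A) → IsIso f → f ≡ id

  -- The set of isomorphism classes ℂ₀/≅ together with its quotient map,
  -- presented (no quotient types in Agda) as a set Cls with a map
  -- q : Obj → Cls whose kernel is exactly ≅ and which has a section s
  -- (hence q is surjective, so Cls ≃ Obj/≅ canonically).
  record IsoClassesWithSection : Set₁ where
    field
      Cls     : Set
      q       : Obj → Cls
      q-ker   : (A B : Obj) → (q A ≡ q B) ⇔ (A ≅ B)
      s       : Cls → Obj
      section : (x : Cls) → q (s x) ≡ x

  record FamObj : Set₁ where
    constructor fam
    field
      Idx : Set
      obj : Idx → Obj
  open FamObj public

  p₀ : FamObj → Set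
  p₀ = Idx

  record FamHom (X Y : FamObj) : Set where
    constructor famHom
    field
      fun : Idx X → Idx Y
      arr : (j : Idx X) → Hom (obj X j) (obj Y (fun j))
  open FamHom public

  p₁ : {X Y : FamObj} → FamHom X Y → p₀ X → p₀ Y
  p₁ = fun

  _∘F_ : {X Y Z : FamObj} → FamHom Y Z → FamHom X Y → FamHom X Z
  famHom u φ ∘F famHom v ψ = famHom (λ k → u (v k)) (λ k → φ (v k) ∘ ψ k)

  -- equality of morphisms in Fam(ℂ) (pointwise; avoids function
  -- extensionality): equal index functions and equal components
  _≈F_ : {X Y : FamObj} → FamHom X Y → FamHom X Y → Set
  _≈F_ {X} {Y} f g =
    Σ[ e ∈ ((j : Idx X) → fun f j ≡ fun g j) ]
      ((j : Idx X) → subst (λ i → Hom (obj X j) (obj Y i)) (e j) (arr f j) ≡ arr g j)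

  IsCartesian : {E F : FamObj} → FamHom E F → Set₁
  IsCartesian {E} {F} f =
    (H : FamObj) (g : FamHom H F) (v : p₀ H → p₀ E) →
    ((x : p₀ H) → p₁ f (v x) ≡ p₁ g x) →
    Σ[ h ∈ FamHom H E ]
      ( ((x : p₀ H) → p₁ h x ≡ v x) × ((f ∘F h) ≈F g)
      × ((h' : FamHom H E) → ((x : p₀ H) → p₁ h' x ≡ v x) → (f ∘F h') ≈F g → h' ≈F h))

  IsStrongGeneric : FamObj → Set₁
  IsStrongGeneric T =
    (X : FamObj) →
    Σ[ f ∈ FamHom X T ] (IsCartesian f × ((f' : FamHom X T) → IsCartesian f' → f' ≈F f))

  T′ : IsoClassesWithSection → FamObj
  T′ Q = fam (IsoClassesWithSection.Cls Q) (IsoClassesWithSection.s Q)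

-- Every morphism of Fam(ℂ) whose components are isomorphisms is cartesian.
-- For an automorphism f of A, pick an isomorphism φ : A → s [A]; then the
-- one-point families (⊤ ↦ A) → T′ with components φ and φ ∘ f are both
-- cartesian, so uniqueness of cartesian morphisms into T′ forces
-- φ ∘ f = φ, and cancelling φ gives f = id.
module Submission where

open import Defs
open import Data.Product using (_,_; proj₁; proj₂)
open import Data.Unit using (⊤; tt)
open import Function.Bundles using (Equivalence)
open import Relation.Binary.PropositionalEquality
  using (_≡_; refl; sym; trans; cong; subst; module ≡-Reasoning)
open import Relation.Binary.PropositionalEquality.Properties
  using (subst-subst; subst-sym-subst)

module _ (ℂ : Category) where
  open Category ℂ
  open ≡-Reasoning

  cancel-inverseˡ : {A B C : Obj} {f : Hom A B} {g : Hom B A} →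
    g ∘ f ≡ id → (h : Hom C A) → g ∘ (f ∘ h) ≡ h
  cancel-inverseˡ {f = f} {g} gf≡id h = begin
    g ∘ (f ∘ h) ≡⟨ assoc g f h ⟨
    (g ∘ f) ∘ h ≡⟨ cong (_∘ h) gf≡id ⟩
    id ∘ h      ≡⟨ identityˡ h ⟩
    h           ∎

  iso-transpose : {A B C : Obj} {f : Hom A B} ((f⁻¹ , _) : IsIso ℂ f)
    {t : Hom C A} {b : Hom C B} → f ∘ t ≡ b → t ≡ f⁻¹ ∘ b
  iso-transpose {f = f} (f⁻¹ , f⁻¹f≡id , _) {t} {b} ft≡b = begin
    t            ≡⟨ cancel-inverseˡ f⁻¹f≡id t ⟨
    f⁻¹ ∘ (f ∘ t) ≡⟨ cong (f⁻¹ ∘_) ft≡b ⟩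
    f⁻¹ ∘ b      ∎

  iso-cancelˡ : {A B C : Obj} {f : Hom A B} → IsIso ℂ f →
    {g h : Hom C A} → f ∘ g ≡ f ∘ h → g ≡ h
  iso-cancelˡ f-iso@(_ , f⁻¹f≡id , _) {h = h} fg≡fh =
    trans (iso-transpose f-iso fg≡fh) (cancel-inverseˡ f⁻¹f≡id h)

  ≅-sym : {A B : Obj} → _≅_ ℂ A B → _≅_ ℂ B A
  ≅-sym (f , f⁻¹ , f⁻¹f≡id , ff⁻¹≡id) = f⁻¹ , f , ff⁻¹≡id , f⁻¹f≡id

  ∘-isIso : {A B C : Obj} {f : Hom B C} {g : Hom A B} →
    IsIso ℂ f → IsIso ℂ g → IsIso ℂ (f ∘ g)
  ∘-isIso {f = f} {g} (f⁻¹ , f⁻¹f≡id , ff⁻¹≡id) (g⁻¹ , g⁻¹g≡id , gg⁻¹≡id) =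
    g⁻¹ ∘ f⁻¹ , inverse g⁻¹g≡id f⁻¹f≡id , inverse ff⁻¹≡id gg⁻¹≡id
    where
    inverse : {X Y Z : Obj} {a : Hom Y Z} {a′ : Hom Z Y} {b : Hom X Y} {b′ : Hom Y X} →
      b′ ∘ b ≡ id → a′ ∘ a ≡ id → (b′ ∘ a′) ∘ (a ∘ b) ≡ id
    inverse {a = a} {a′} {b} {b′} b′b≡id a′a≡id = begin
      (b′ ∘ a′) ∘ (a ∘ b) ≡⟨ assoc b′ a′ (a ∘ b) ⟩
      b′ ∘ (a′ ∘ (a ∘ b)) ≡⟨ cong (b′ ∘_) (cancel-inverseˡ a′a≡id b) ⟩
      b′ ∘ b              ≡⟨ b′b≡id ⟩
      id                  ∎

  ≈F-sym : {X Y : FamObj ℂ} {f g : FamHom ℂ X Y} → _≈F_ ℂ f g → _≈F_ ℂ g f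
  ≈F-sym {X} {Y} {f} {g} (e , d) = (λ j → sym (e j)) , λ j → begin
    subst (P j) (sym (e j)) (arr g j)                         ≡⟨ cong (subst (P j) (sym (e j))) (d j) ⟨
    subst (P j) (sym (e j)) (subst (P j) (e j) (arr f j))     ≡⟨ subst-sym-subst (e j) ⟩
    arr f j                                                   ∎
    where
    P : Idx X → Idx Y → Set
    P j i = Hom (obj X j) (obj Y i)

  ≈F-trans : {X Y : FamObj ℂ} {f g h : FamHom ℂ X Y} →
    _≈F_ ℂ f g → _≈F_ ℂ g h → _≈F_ ℂ f h
  ≈F-trans {X} {Y} {f} {g} {h} (e , d) (e′ , d′) = (λ j → trans (e j) (e′ j)) , λ j → begin
    subst (P j) (trans (e j) (e′ j)) (arr f j)        ≡⟨ subst-subst (e j) ⟨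
    subst (P j) (e′ j) (subst (P j) (e j) (arr f j))  ≡⟨ cong (subst (P j) (e′ j)) (d j) ⟩
    subst (P j) (e′ j) (arr g j)                      ≡⟨ d′ j ⟩
    arr h j                                           ∎
    where
    P : Idx X → Idx Y → Set
    P j i = Hom (obj X j) (obj Y i)

  -- Uses K: the index paths of the equivalence are loops, hence refl.
  ≈F⇒arr≡ : {X Y : FamObj ℂ} {u : Idx X → Idx Y}
    {φ ψ : (j : Idx X) → Hom (obj X j) (obj Y (u j))} →
    _≈F_ ℂ {X} {Y} (famHom u φ) (famHom u ψ) → (j : Idx X) → φ j ≡ ψ j
  ≈F⇒arr≡ (e , d) j with e j | d j
  ... | refl | φj≡ψj = φj≡ψj

  isIso-components⇒isCartesian : {E F : FamObj ℂ} (f : FamHom ℂ E F) →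
    ((j : Idx E) → IsIso ℂ (arr f j)) → IsCartesian ℂ f
  isIso-components⇒isCartesian {E} {F} f f-iso H g v fv≡g =
    lift , (λ _ → refl) , (fv≡g , lift-triangle) , lift-unique
    where
    P : Idx H → Idx F → Set
    P x i = Hom (obj H x) (obj F i)

    f⁻¹ : (j : Idx E) → Hom (obj F (fun f j)) (obj E j)
    f⁻¹ j = proj₁ (f-iso j)

    lift : FamHom ℂ H E
    lift = famHom v λ x → f⁻¹ (v x) ∘ subst (P x) (sym (fv≡g x)) (arr g x)

    transport-section : {x : Idx H} {j : Idx E} {k : Idx F} (e : fun f j ≡ k) (b : P x k) →
      subst (P x) e (arr f j ∘ (f⁻¹ j ∘ subst (P x) (sym e) b)) ≡ b
    transport-section {j = j} refl b = cancel-inverseˡ (proj₂ (proj₂ (f-iso j))) b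

    lift-triangle : (x : Idx H) →
      subst (P x) (fv≡g x) (arr f (v x) ∘ arr lift x) ≡ arr g x
    lift-triangle x = transport-section (fv≡g x) (arr g x)

    transport-transpose : {x : Idx H} {j j′ : Idx E} {k : Idx F} (p : j ≡ j′)
      (e : fun f j ≡ k) (e′ : fun f j′ ≡ k) (t : Hom (obj H x) (obj E j)) (b : P x k) →
      subst (P x) e (arr f j ∘ t) ≡ b →
      subst (λ i → Hom (obj H x) (obj E i)) p t ≡ f⁻¹ j′ ∘ subst (P x) (sym e′) b
    transport-transpose {j = j} refl refl refl t b = iso-transpose (f-iso j)

    lift-unique : (h : FamHom ℂ H E) → ((x : Idx H) → fun h x ≡ v x) →
      _≈F_ ℂ (_∘F_ ℂ f h) g → _≈F_ ℂ h lift
    lift-unique h hv≡v (e , d) =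
      hv≡v , λ x → transport-transpose (hv≡v x) (e x) (fv≡g x) (arr h x) (arr g x) (d x)

  point : Obj → FamObj ℂ
  point A = fam ⊤ λ _ → A

  pointHom : {A : Obj} {Y : FamObj ℂ} (i : Idx Y) → Hom A (obj Y i) → FamHom ℂ (point A) Y
  pointHom i χ = famHom (λ _ → i) (λ _ → χ)

  cartesian-unique⇒iso-unique : {A : Obj} {Y : FamObj ℂ} →
    ((f g : FamHom ℂ (point A) Y) → IsCartesian ℂ f → IsCartesian ℂ g → _≈F_ ℂ f g) →
    (i : Idx Y) {χ χ′ : Hom A (obj Y i)} → IsIso ℂ χ → IsIso ℂ χ′ → χ ≡ χ′
  cartesian-unique⇒iso-unique {A} {Y} unique i χ-iso χ′-iso =
    ≈F⇒arr≡ (unique (pointHom i _) (pointHom i _) (cartesian χ-iso) (cartesian χ′-iso)) tt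
    where
    cartesian : {χ : Hom A (obj Y i)} → IsIso ℂ χ → IsCartesian ℂ (pointHom i χ)
    cartesian χ-iso = isIso-components⇒isCartesian (pointHom i _) λ _ → χ-iso

mainTheorem4 : (ℂ : Category) (Q : IsoClassesWithSection ℂ) →
    IsStrongGeneric ℂ (T′ ℂ Q) → Gaunt ℂ
mainTheorem4 ℂ Q generic {A} f f-iso =
  iso-cancelˡ ℂ φ-iso (trans φf≡φ (sym (identityʳ φ)))
  where
  open Category ℂ
  open IsoClassesWithSection Q

  unique : (k k′ : FamHom ℂ (point ℂ A) (T′ ℂ Q)) →
    IsCartesian ℂ k → IsCartesian ℂ k′ → _≈F_ ℂ k k′
  unique k k′ k-cart k′-cart =
    let _ , _ , only = generic (point ℂ A)
    in ≈F-trans ℂ (only k k-cart) (≈F-sym ℂ (only k′ k′-cart))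

  A≅s[A] : _≅_ ℂ A (s (q A))
  A≅s[A] = ≅-sym ℂ (Equivalence.to (q-ker (s (q A)) A) (section (q A)))

  φ : Hom A (s (q A))
  φ = proj₁ A≅s[A]

  φ-iso : IsIso ℂ φ
  φ-iso = proj₂ A≅s[A]

  φf≡φ : φ ∘ f ≡ φ
  φf≡φ = cartesian-unique⇒iso-unique ℂ unique (q A) (∘-isIso ℂ φ-iso f-iso) φ-iso
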